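{- If $\varrho=\sqcap_\Delta M$ and $(\varrho', \zeta, \varsigma) \models_{\beta} cl_j$ for all $\varrho' \in M$, then $(\varrho, \zeta, \varsigma) \models_{\beta} cl_j$.
   Context: LLFP is interpreted over a non-empty finite universe $\mathcal{U}$ and a complete lattice $(\mathcal{L},\sqsubseteq)$ satisfying the Ascending Chain Condition, with an anti-monotone complement $\complement$ and a representation function $\beta:\mathcal{U}\to\mathcal{L}$; $\varsigma$ maps variables $x$ to $\mathcal{U}$ and $Y$ to $\mathcal{L}\setminus\{\bot\}$; $\zeta$ maps function symbols to monotone functions $\mathcal{L}^k\to\mathcal{L}$. Preconditions: $R(\vec u;V)$ holds iff $\varrho(R)(\varsigma(\vec u)) \sqsupseteq \varsigma(V)$; $\neg R(\vec u;V)$ iff $\complement(\varrho(R)(\varsigma(\vec u))) \sqsupseteq \varsigma(V)$; $Y(u)$ iff $\beta(\varsigma(u))\sqsubseteq\varsigma(Y)$; $\wedge,\vee,\exists x,\exists Y$ as usual. Clauses: $(\varrho,\zeta,\varsigma)\models_\beta R(\vec u;V')$ iff $\varrho(R)(\llbracket\vec u\rrbracket(\zeta,\varsigma)) \sqsupseteq \llbracket V'\rrbracket(\zeta,\varsigma)$; $\mathbf{1}$ always holds; $cl_1\wedge cl_2$, $pre\Rightarrow cl$ (holds if $cl$ holds whenever $pre$ holds), $\forall x:cl$ (over $\mathcal{U}$), $\forall Y:cl$ (over $\mathcal{L}\setminus\{\bot\}$) as usual. $cls=cl_1,\ldots,cl_s$ is stratified by $\mathrm{rank}$: assertions of $R$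 in $cl_i$ have $\mathrm{rank}(R)=i$, positive queries in $cl_i$ have rank $\le i$, negative queries in $cl_i$ have rank $<i$. $\Delta$ is the set of interpretations $\varrho$ mapping each predicate $R$ of arity $k$ to $\mathcal{U}^k\to\mathcal{L}$, ordered lexicographically by strata ($\varrho_1\preceq\varrho_2$ iff for some $1\le j\le s$: equal on ranks $<j$, pointwise $\sqsubseteq$ on rank $j$, and either $j=s$ or strictly smaller on some rank-$j$ relation). For $M\subseteq\Delta$, its greatest lower bound in $(\Delta,\preceq)$ is $(\sqcap_\Delta M)(R)=\lambda\vec a.\ \mathrm{glb}_{\mathcal{L}}\{\varrho(R)(\vec a)\mid\varrho\in M_{\mathrm{rank}(R)}\}$, where $\mathrm{glb}_{\mathcal{L}}$ is the greatest lower bound in $\mathcal{L}$ and $M_j=\{\varrho\in M\mid \forall R'$ with $\mathrm{rank}(R')<j:\ \varrho(R')=(\sqcap_\Delta M)(R')\}$. -}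

module Defs where

open import Data.Nat using (ℕ) renaming (_≟_ to _≟ℕ_)
open import Data.Fin using (Fin; _<_; _≤_)
open import Data.Fin.Induction using (<-wellFounded)
open import Data.Vec using (Vec; map; lookup)
open import Data.Vec.Relation.Binary.Pointwise.Inductive using (Pointwise)
open import Data.Product using (Σ; _×_; _,_)
open import Data.Sum using (_⊎_)
open import Data.Unit using (⊤)
open import Relation.Nullary using (¬_; yes; no)
open import Relation.Binary.PropositionalEquality using (_≡_; _≢_)
open import Induction.WellFounded using (WellFounded; Acc; acc)

record CompleteLattice : Set₁ where
  field
    Carrier   : Set
    _⊑_       : Carrier → Carrier → Set
    ⊑-refl    : ∀ {x} → x ⊑ x
    ⊑-trans   : ∀ {x y z} → x ⊑ y → y ⊑ z → x ⊑ z
    ⊑-antisym : ∀ {x y} → x ⊑ y → y ⊑ x → x ≡ y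
    ⨅          : (Carrier → Set) → Carrier
    ⨅-lower    : ∀ (P : Carrier → Set) x → P x → ⨅ P ⊑ x
    ⨅-greatest : ∀ (P : Carrier → Set) y → (∀ x → P x → y ⊑ x) → y ⊑ ⨅ P

  _⊏_ : Carrier → Carrier → Set
  x ⊏ y = x ⊑ y × x ≢ y

  field
    -- Ascending Chain Condition: no infinite strictly ascending chains,
    -- i.e. the converse of ⊏ is well-founded.
    acc-condition : WellFounded (λ x y → y ⊏ x)

  ⊥L : Carrier
  ⊥L = ⨅ (λ _ → ⊤)

module LLFP (L : CompleteLattice) (N : ℕ)
            (Pred : Set) (arity : Pred → ℕ)
            (Fun : Set) (farity : Fun → ℕ) where

  open CompleteLattice L

  U : Set
  U = Fin (ℕ.suc N)

  data UTerm : Set where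
    var   : ℕ → UTerm
    const : U → UTerm

  data LTerm : Set where
    lvar : ℕ → LTerm
    app  : (f : Fun) → Vec LTerm (farity f) → LTerm

  data Pre : Set where
    rel  : (R : Pred) → Vec UTerm (arity R) → ℕ → Pre
    nrel : (R : Pred) → Vec UTerm (arity R) → ℕ → Pre
    mem  : ℕ → UTerm → Pre
    _∧ₚ_ : Pre → Pre → Pre
    _∨ₚ_ : Pre → Pre → Pre
    ∃x   : ℕ → Pre → Pre
    ∃Y   : ℕ → Pre → Pre

  data Clause : Set where
    assert : (R : Pred) → Vec UTerm (arity R) → LTerm → Clause
    𝟏      : Clause
    _∧c_   : Clause → Clause → Clause
    _⇒_    : Pre → Clause → Clause
    ∀x     : ℕ → Clause → Clause
    ∀Y     : ℕ → Clause → Clause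

  -- interpretations of predicates (elements of Δ)
  Interp : Set
  Interp = (R : Pred) → Vec U (arity R) → Carrier

  FunInterp : Set
  FunInterp = (f : Fun) → Vec Carrier (farity f) → Carrier

  MonotoneFI : FunInterp → Set
  MonotoneFI ζ = ∀ f (xs ys : Vec Carrier (farity f)) →
                 Pointwise _⊑_ xs ys → ζ f xs ⊑ ζ f ys

  record Env : Set where
    field
      uval   : ℕ → U
      lval   : ℕ → Carrier
      lval≢⊥ : ∀ Y → lval Y ≢ ⊥L
  open Env public

  _[x_↦_] : Env → ℕ → U → Env
  uval   (ς [x x ↦ a ]) y with y ≟ℕ x
  ... | yes _ = a
  ... | no  _ = uval ς y
  lval   (ς [x x ↦ a ]) = lval ς
  lval≢⊥ (ς [x x ↦ a ]) = lval≢⊥ ς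

  _[Y_↦_,_] : Env → ℕ → (l : Carrier) → l ≢ ⊥L → Env
  uval   (ς [Y Y ↦ l , nz ]) = uval ς
  lval   (ς [Y Y ↦ l , nz ]) Z with Z ≟ℕ Y
  ... | yes _ = l
  ... | no  _ = lval ς Z
  lval≢⊥ (ς [Y Y ↦ l , nz ]) Z with Z ≟ℕ Y
  ... | yes _ = nz
  ... | no  _ = lval≢⊥ ς Z

  ⟦_⟧u : UTerm → Env → U
  ⟦ var x   ⟧u ς = uval ς x
  ⟦ const a ⟧u ς = a

  ⟦_⟧us : ∀ {k} → Vec UTerm k → Env → Vec U k
  ⟦ us ⟧us ς = map (λ u → ⟦ u ⟧u ς) us

  mutual
    ⟦_⟧V : LTerm → FunInterp → Env → Carrier
    ⟦ lvar Y   ⟧V ζ ς = lval ς Y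
    ⟦ app f Vs ⟧V ζ ς = ζ f (⟦ Vs ⟧Vs ζ ς)

    ⟦_⟧Vs : ∀ {k} → Vec LTerm k → FunInterp → Env → Vec Carrier k
    ⟦ Vec.[] ⟧Vs ζ ς = Vec.[]
    ⟦ V Vec.∷ Vs ⟧Vs ζ ς = ⟦ V ⟧V ζ ς Vec.∷ ⟦ Vs ⟧Vs ζ ς

  module Semantics (∁ : Carrier → Carrier) (β : U → Carrier) where

    SatPre : Interp → Env → Pre → Set
    SatPre ρ ς (rel R us Y)  = lval ς Y ⊑ ρ R (⟦ us ⟧us ς)
    SatPre ρ ς (nrel R us Y) = lval ς Y ⊑ ∁ (ρ R (⟦ us ⟧us ς))
    SatPre ρ ς (mem Y u)     = β (⟦ u ⟧u ς) ⊑ lval ς Y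
    SatPre ρ ς (p ∧ₚ q)      = SatPre ρ ς p × SatPre ρ ς q
    SatPre ρ ς (p ∨ₚ q)      = SatPre ρ ς p ⊎ SatPre ρ ς q
    SatPre ρ ς (∃x x p)      = Σ U λ a → SatPre ρ (ς [x x ↦ a ]) p
    SatPre ρ ς (∃Y Y p)      = Σ Carrier λ l → Σ (l ≢ ⊥L) λ nz →
                                 SatPre ρ (ς [Y Y ↦ l , nz ]) p

    Sat : Interp → FunInterp → Env → Clause → Set
    Sat ρ ζ ς (assert R us V) = ⟦ V ⟧V ζ ς ⊑ ρ R (⟦ us ⟧us ς)
    Sat ρ ζ ς 𝟏               = ⊤
    Sat ρ ζ ς (c ∧c d)        = Sat ρ ζ ς c × Sat ρ ζ ς d
    Sat ρ ζ ς (p ⇒ c)         = SatPre ρ ς p → Sat ρ ζ ς c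
    Sat ρ ζ ς (∀x x c)        = ∀ (a : U) → Sat ρ ζ (ς [x x ↦ a ]) c
    Sat ρ ζ ς (∀Y Y c)        = ∀ (l : Carrier) (nz : l ≢ ⊥L) →
                                  Sat ρ ζ (ς [Y Y ↦ l , nz ]) c

  -- Stratification with s strata (stratum indices Fin s, 0-based).
  module Strata {s : ℕ} (rank : Pred → Fin s) where

    PreOK : Fin s → Pre → Set
    PreOK j (rel R us Y)  = rank R ≤ j
    PreOK j (nrel R us Y) = rank R < j
    PreOK j (mem Y u)     = ⊤
    PreOK j (p ∧ₚ q)      = PreOK j p × PreOK j q
    PreOK j (p ∨ₚ q)      = PreOK j p × PreOK j q
    PreOK j (∃x x p)      = PreOK j p
    PreOK j (∃Y Y p)      = PreOK j p

    ClauseOK : Fin s → Clause → Set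
    ClauseOK j (assert R us V) = rank R ≡ j
    ClauseOK j 𝟏               = ⊤
    ClauseOK j (c ∧c d)        = ClauseOK j c × ClauseOK j d
    ClauseOK j (p ⇒ c)         = PreOK j p × ClauseOK j c
    ClauseOK j (∀x x c)        = ClauseOK j c
    ClauseOK j (∀Y Y c)        = ClauseOK j c

    Stratified : Vec Clause s → Set
    Stratified cls = ∀ (i : Fin s) → ClauseOK i (lookup cls i)

    -- ⊓_Δ M, defined by well-founded recursion on the rank:
    -- (⊓M)(R)(ā) = glb { ϱ(R)(ā) | ϱ ∈ M_rank(R) },
    -- M_j = { ϱ ∈ M | ∀ R', rank R' < j → ϱ(R') = (⊓M)(R') }.
    glbΔ-acc : (M : Interp → Set) (R : Pred) → Acc _<_ (rank R) →
               Vec U (arity R) → Carrier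
    glbΔ-acc M R (acc rs) a =
      ⨅ (λ l → Σ Interp λ ρ' → M ρ' ×
             (∀ R' → (lt : rank R' < rank R) → ∀ b →
                ρ' R' b ≡ glbΔ-acc M R' (rs lt) b) ×
             l ≡ ρ' R a)

    glbΔ : (M : Interp → Set) → Interp
    glbΔ M R = glbΔ-acc M R (<-wellFounded (rank R))

-- The glb ϱ = ⊓_Δ M agrees with every ϱ' ∈ M_j below stratum j and lies below it on
-- stratum j.  Hence every precondition admitted in cl_j (positive queries of rank ≤ j,
-- negative ones of rank < j) that holds for ϱ also holds for each ϱ' ∈ M_j, while an
-- assertion R(ū;V') of cl_j has rank R = j, so ϱ(R) is the glb of the ϱ'(R) with
-- ϱ' ∈ M_j and lies above ⟦V'⟧ as soon as each of them does.
module Submission where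

open import Defs
open import Data.Nat using (ℕ)
open import Data.Fin using (Fin; _<_; _≤_)
open import Data.Fin.Properties using (≤∧≢⇒<) renaming (_≟_ to _≟ᶠ_)
open import Data.Fin.Induction using (<-wellFounded)
open import Data.Vec using (Vec; lookup)
open import Data.Product using (_×_; _,_; proj₁; proj₂)
open import Data.Sum using (inj₁; inj₂)
open import Data.Unit using (tt)
open import Induction.WellFounded using (Acc; acc; WfRec)
open import Relation.Binary.PropositionalEquality using (_≡_; refl; sym; trans; subst)
open import Relation.Nullary using (yes; no)

module _ (L : CompleteLattice) where
  open CompleteLattice L

  ⨅-antitone : {P Q : Carrier → Set} → (∀ x → P x → Q x) → ⨅ Q ⊑ ⨅ P
  ⨅-antitone {P} {Q} P⊆Q = ⨅-greatest P (⨅ Q) (λ x Px → ⨅-lower Q x (P⊆Q x Px))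

module _ (L : CompleteLattice) (N : ℕ)
         (Pred : Set) (arity : Pred → ℕ) (Fun : Set) (farity : Fun → ℕ)
         {s : ℕ} (rank : Pred → Fin s) where
  open CompleteLattice L
  open LLFP L N Pred arity Fun farity
  open Strata rank

  AgreeBelow : Fin s → Interp → Interp → Set
  AgreeBelow j ρ ρ' = ∀ R → rank R < j → ∀ a → ρ R a ≡ ρ' R a

  -- glbΔ evaluates each rank with the canonical accessibility proof, whereas the
  -- recursive calls inside glbΔ-acc use the ones handed down by the outer proof.
  glbΔ-acc-irrelevant : ∀ M R (p q : Acc _<_ (rank R)) a →
                        glbΔ-acc M R p a ≡ glbΔ-acc M R q a
  glbΔ-acc-irrelevant M R (acc rs) (acc qs) a =
    ⊑-antisym (⨅-antitone L λ { l (ρ' , m , agr , l≡) → ρ' , m , reindex ρ' qs rs agr , l≡ })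
              (⨅-antitone L λ { l (ρ' , m , agr , l≡) → ρ' , m , reindex ρ' rs qs agr , l≡ })
    where
    reindex : ∀ ρ' (rs qs : WfRec _<_ (Acc _<_) (rank R)) →
              (∀ R' (lt : rank R' < rank R) → ∀ b → ρ' R' b ≡ glbΔ-acc M R' (rs lt) b) →
              (∀ R' (lt : rank R' < rank R) → ∀ b → ρ' R' b ≡ glbΔ-acc M R' (qs lt) b)
    reindex ρ' rs qs agr R' lt b =
      trans (agr R' lt b) (glbΔ-acc-irrelevant M R' (rs lt) (qs lt) b)

  glbΔ-lower : ∀ M {ρ'} R a → M ρ' → AgreeBelow (rank R) ρ' (glbΔ M) →
               glbΔ M R a ⊑ ρ' R a
  glbΔ-lower M {ρ'} R a m agr = go (<-wellFounded (rank R))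
    where
    go : (ac : Acc _<_ (rank R)) → glbΔ-acc M R ac a ⊑ ρ' R a
    go (acc rs) = ⨅-lower _ _
      (ρ' , m , (λ R' lt b → trans (agr R' lt b)
                   (glbΔ-acc-irrelevant M R' (<-wellFounded (rank R')) (rs lt) b)) , refl)

  glbΔ-greatest : ∀ M R a {l} →
                  (∀ ρ' → M ρ' → AgreeBelow (rank R) ρ' (glbΔ M) → l ⊑ ρ' R a) →
                  l ⊑ glbΔ M R a
  glbΔ-greatest M R a {l} bound = go (<-wellFounded (rank R))
    where
    go : (ac : Acc _<_ (rank R)) → l ⊑ glbΔ-acc M R ac a
    go (acc rs) = ⨅-greatest _ _ λ { _ (ρ' , m , agr , refl) →
      bound ρ' m (λ R' lt b → trans (agr R' lt b)
                   (glbΔ-acc-irrelevant M R' (rs lt) (<-wellFounded (rank R')) b)) }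

  module _ (∁ : Carrier → Carrier) (β : U → Carrier) where
    open Semantics ∁ β

    satPre-mono : ∀ {j ρ ρ' ς} →
                  (∀ R → rank R ≤ j → ∀ a → ρ R a ⊑ ρ' R a) → AgreeBelow j ρ' ρ →
                  ∀ p → PreOK j p → SatPre ρ ς p → SatPre ρ' ς p
    satPre-mono ≤ρ' _ (rel R us Y) ok sat = ⊑-trans sat (≤ρ' R ok _)
    satPre-mono {ς = ς} _ agr (nrel R us Y) ok sat =
      subst (λ z → lval ς Y ⊑ ∁ z) (sym (agr R ok _)) sat
    satPre-mono _ _ (mem Y u) _ sat = sat
    satPre-mono ≤ρ' agr (p ∧ₚ q) (okp , okq) (satp , satq) =
      satPre-mono ≤ρ' agr p okp satp , satPre-mono ≤ρ' agr q okq satq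
    satPre-mono ≤ρ' agr (p ∨ₚ q) (okp , _) (inj₁ satp) = inj₁ (satPre-mono ≤ρ' agr p okp satp)
    satPre-mono ≤ρ' agr (p ∨ₚ q) (_ , okq) (inj₂ satq) = inj₂ (satPre-mono ≤ρ' agr q okq satq)
    satPre-mono ≤ρ' agr (∃x x p) ok (a , sat) = a , satPre-mono ≤ρ' agr p ok sat
    satPre-mono ≤ρ' agr (∃Y Y p) ok (l , l≢⊥ , sat) = l , l≢⊥ , satPre-mono ≤ρ' agr p ok sat

    module _ (M : Interp → Set) {ρ : Interp} (ρ≡glbΔ : ∀ R a → ρ R a ≡ glbΔ M R a) where

      private
        toGlbΔ : ∀ {j ρ'} → AgreeBelow j ρ' ρ → AgreeBelow j ρ' (glbΔ M)
        toGlbΔ agr R lt a = trans (agr R lt a) (ρ≡glbΔ R a)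

      ⊓-lower : ∀ {j ρ'} R → rank R ≤ j → M ρ' → AgreeBelow j ρ' ρ →
                ∀ a → ρ R a ⊑ ρ' R a
      ⊓-lower {j} R R≤j m agr a with rank R ≟ᶠ j
      ... | yes refl = subst (_⊑ _) (sym (ρ≡glbΔ R a)) (glbΔ-lower M R a m (toGlbΔ agr))
      ... | no R≢j = subst (ρ R a ⊑_) (sym (agr R (≤∧≢⇒< R≤j R≢j) a)) ⊑-refl

      ⊓-greatest : ∀ R a {l} → (∀ ρ' → M ρ' → AgreeBelow (rank R) ρ' ρ → l ⊑ ρ' R a) →
                   l ⊑ ρ R a
      ⊓-greatest R a bound =
        subst (_ ⊑_) (sym (ρ≡glbΔ R a)) (glbΔ-greatest M R a (λ ρ' m agr →
          bound ρ' m (λ R' lt b → trans (agr R' lt b) (sym (ρ≡glbΔ R' b)))))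

      sat-⊓ : ∀ {j} (ζ : FunInterp) {ς} c → ClauseOK j c →
              (∀ ρ' → M ρ' → AgreeBelow j ρ' ρ → Sat ρ' ζ ς c) → Sat ρ ζ ς c
      sat-⊓ ζ (assert R us V) refl sat = ⊓-greatest R _ sat
      sat-⊓ ζ 𝟏 _ _ = tt
      sat-⊓ ζ (c ∧c d) (okc , okd) sat =
        sat-⊓ ζ c okc (λ ρ' m agr → proj₁ (sat ρ' m agr)) ,
        sat-⊓ ζ d okd (λ ρ' m agr → proj₂ (sat ρ' m agr))
      sat-⊓ ζ (p ⇒ c) (okp , okc) sat satp = sat-⊓ ζ c okc λ ρ' m agr →
        sat ρ' m agr (satPre-mono (λ R R≤j → ⊓-lower R R≤j m agr) agr p okp satp)
      sat-⊓ ζ (∀x x c) ok sat a = sat-⊓ ζ c ok (λ ρ' m agr → sat ρ' m agr a)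
      sat-⊓ ζ (∀Y Y c) ok sat l l≢⊥ = sat-⊓ ζ c ok (λ ρ' m agr → sat ρ' m agr l l≢⊥)

lemma4 : (L : CompleteLattice) (N : ℕ)
         (Pred : Set) (arity : Pred → ℕ) (Fun : Set) (farity : Fun → ℕ) →
         let open CompleteLattice L
             open LLFP L N Pred arity Fun farity
         in (∁ : Carrier → Carrier) → (∀ {x y} → x ⊑ y → ∁ y ⊑ ∁ x) →
            (β : U → Carrier) →
            let open Semantics ∁ β
            in (s : ℕ) (rank : Pred → Fin s) (cls : Vec Clause s) →
               let open Strata rank
               in Stratified cls →
                  (ζ : FunInterp) → MonotoneFI ζ → (ς : Env) →
                  (M : Interp → Set) (ρ : Interp) →
                  (∀ R a → ρ R a ≡ glbΔ M R a) →
                  (j : Fin s) →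
                  (∀ ρ' → M ρ' → Sat ρ' ζ ς (lookup cls j)) →
                  Sat ρ ζ ς (lookup cls j)
lemma4 L N Pred arity Fun farity ∁ _ β s rank cls stratified ζ _ ς M ρ ρ≡glbΔ j sat =
  sat-⊓ L N Pred arity Fun farity rank ∁ β M ρ≡glbΔ ζ (lookup cls j) (stratified j)
    (λ ρ' m _ → sat ρ' m)
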